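{- Let $\mathrm{EVEN}_n=\{x\in\{0,1\}^n: \sum_{i=1}^n x_i \text{ is even}\}$. Then $\mathrm{rc}(\mathrm{EVEN}_n)=\Theta(2^n)$.
   Context: For $X\subseteq\mathbb{Z}^d$, a polyhedron $R\subseteq\mathbb{R}^d$ is called a relaxation for $X$ if $R\cap\mathbb{Z}^d=\mathrm{conv}(X)\cap\mathbb{Z}^d$. The relaxation complexity $\mathrm{rc}(X)$ is the smallest number of facets of any relaxation for $X$. -}

module Defs where

open import Level using (0ℓ)
open import Data.Nat using (ℕ; zero; suc)
open import Data.Fin using (Fin)
import Data.Integer as ℤ
open import Data.Integer using (ℤ; +_; -[1+_])
open import Data.Integer.Divisibility using (_∣_)
open import Data.Product using (Σ; ∃; _×_; _,_)
open import Data.Sum using (_⊎_)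
open import Relation.Binary.PropositionalEquality using (_≡_)
open import Relation.Binary.Structures using (IsStrictTotalOrder)
open import Algebra.Structures using (IsCommutativeRing)
open import Relation.Nullary using (¬_)

-- The real numbers, axiomatised as a Dedekind-complete ordered field.
-- (The standard library has no reals; every complete ordered field is
-- isomorphic to ℝ, so quantifying over all of them states the result
-- for ℝ.)

record RealField : Set₁ where
  infixl 7 _*_
  infixl 6 _+_
  infix  4 _<_ _≤_
  field
    Carrier : Set
    _+_ _*_ : Carrier → Carrier → Carrier
    -_      : Carrier → Carrier
    0# 1#   : Carrier
    _<_     : Carrier → Carrier → Set
    isCommutativeRing : IsCommutativeRing _≡_ _+_ _*_ -_ 0# 1#
    isStrictTotalOrder : IsStrictTotalOrder _≡_ _<_
    0≢1      : ¬ (0# ≡ 1#)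
    inverse  : ∀ x → ¬ (x ≡ 0#) → ∃ λ y → x * y ≡ 1#
    +-mono-< : ∀ {x y} z → x < y → x + z < y + z
    *-pos    : ∀ {x y} → 0# < x → 0# < y → 0# < x * y

  _≤_ : Carrier → Carrier → Set
  x ≤ y = x < y ⊎ x ≡ y

  UpperBound : (Carrier → Set) → Carrier → Set
  UpperBound P u = ∀ x → P x → x ≤ u

  field
    complete : (P : Carrier → Set) → ∃ P → ∃ (UpperBound P) →
               ∃ λ s → UpperBound P s × (∀ u → UpperBound P u → s ≤ u)

module _ (F : RealField) where
  open RealField F

  ι : ℤ → Carrier
  ιℕ : ℕ → Carrier
  ιℕ zero    = 0#
  ιℕ (suc n) = 1# + ιℕ n
  ι (+ n)      = ιℕ n
  ι -[1+ n ]   = - (1# + ιℕ n)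

  Σ[_] : ∀ {k} → (Fin k → Carrier) → Carrier
  Σ[_] {zero}  f = 0#
  Σ[_] {suc k} f = f Fin.zero + Σ[_] (λ i → f (Fin.suc i))
    where import Data.Fin as Fin

  Point : ℕ → Set
  Point d = Fin d → Carrier

  embed : ∀ {d} → (Fin d → ℤ) → Point d
  embed z j = ι (z j)

  record System (d m : ℕ) : Set where
    field
      A : Fin m → Fin d → Carrier
      b : Fin m → Carrier

  _∈P_ : ∀ {d m} → Point d → System d m → Set
  x ∈P S = ∀ i → Σ[ (λ j → System.A S i j * x j) ] ≤ System.b S i

  _∈conv_ : ∀ {d} → Point d → ((Fin d → ℤ) → Set) → Set
  _∈conv_ {d} x X =
    Σ ℕ λ k → Σ (Fin k → Fin d → ℤ) λ p → Σ (Fin k → Carrier) λ w →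
      (∀ i → X (p i)) × (∀ i → 0# ≤ w i) × (Σ[ w ] ≡ 1#) ×
      (∀ j → Σ[ (λ i → w i * ι (p i j)) ] ≡ x j)

  IsRelaxation : ∀ {d m} → ((Fin d → ℤ) → Set) → System d m → Set
  IsRelaxation X S = ∀ z → ((embed z ∈P S → embed z ∈conv X) ×
                            (embed z ∈conv X → embed z ∈P S))

sumℤ : ∀ {n} → (Fin n → ℤ) → ℤ
sumℤ {zero}  z = + 0
sumℤ {suc n} z = z Fin.zero ℤ.+ sumℤ (λ i → z (Fin.suc i))
  where import Data.Fin as Fin

EVEN : (n : ℕ) → (Fin n → ℤ) → Set
EVEN n x = (∀ i → x i ≡ + 0 ⊎ x i ≡ + 1) × (+ 2 ∣ sumℤ x)

module Submission where

-- In the box 0 ≤ x ≤ 1 the only integer points are the vertices of the cube, and an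
-- odd vertex y is cut off by the inequality  Σ_{y_j = 1} x_j − Σ_{y_j = 0} x_j ≤ |y| − 1.  At a
-- vertex x its left-hand side is |y| − d(y, x) for the Hamming distance d, and d(y, x) ≥ 1 when x
-- is even, since x and y then have different parities.  This gives 2ⁿ + 2n ≤ 3 · 2ⁿ inequalities.
--
-- An odd vertex lies outside conv(EVENₙ), so it violates some inequality of every
-- relaxation.  Two odd vertices y, y′ that differ in a coordinate p cannot violate the same
-- inequality a · x ≤ β: flipping coordinate p in both gives even vertices z, z′ with y + y′ = z + z′,
-- so a · y + a · y′ = a · z + a · z′ ≤ 2β.  The 2ⁿ odd vertices of {0,1}ⁿ⁺¹ are pairwise distinct,
-- so every relaxation of EVENₙ₊₁ has at least 2ⁿ inequalities.

open import Defs
open import Level using (0ℓ)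
open import Algebra.Bundles using (CommutativeRing)
open import Algebra.Structures using (IsCommutativeRing)
import Algebra.Properties.CommutativeSemigroup
import Algebra.Properties.Monoid.Sum
import Algebra.Properties.Ring
import Algebra.Properties.Semiring.Sum
open import Data.Bool.Base using (Bool; true; false; not; _xor_)
open import Data.Bool.Properties using (¬-not; xor-same) renaming (_≟_ to _≟ᵇ_)
open import Data.Empty using (⊥; ⊥-elim)
open import Data.Fin.Base using (Fin; zero; suc; punchIn; splitAt; _↑ˡ_; _↑ʳ_; finToFun; funToFin; combine)
open import Data.Fin.Properties
  using (2↔Bool; finToFun-funToFin; funToFin-finToFin; ¬∀⟶∃¬; injective⇒≤; splitAt-↑ˡ; splitAt-↑ʳ)
  renaming (_≟_ to _≟ᶠ_)
open import Data.Integer.Base as ℤ using (ℤ; +_; -[1+_]; ∣_∣)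
open import Data.Nat.Base as ℕ using (ℕ; zero; suc; parity; _^_; z≤n; s≤s)
open import Data.Nat.Divisibility using (_∣_; divides; ∣-refl; ∣m∣n⇒∣m+n)
import Data.Nat.Properties as ℕₚ
open import Data.Parity.Base using (Parity; 0ℙ; 1ℙ; _⁻¹)
open import Data.Parity.Properties using (+-homo-+; *-homo-*; *-zeroʳ; suc-homo-⁻¹)
open import Data.Product using (Σ; ∃; _×_; _,_; proj₁; proj₂)
open import Data.Sum using (_⊎_; inj₁; inj₂; [_,_]; [_,_]′)
open import Data.Vec.Functional using (_∷_; removeAt; updateAt)
open import Data.Vec.Functional.Properties using (updateAt-updates; updateAt-minimal)
open import Function.Base using (_∘_)
open import Function.Bundles using (Inverse; Equivalence; _⇔_; mk⇔)
open import Function.Definitions using (Injective)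
open import Relation.Binary.Bundles using (StrictTotalOrder)
open import Relation.Binary.Definitions using (tri<; tri≈; tri>)
open import Relation.Binary.PropositionalEquality
  using (_≡_; _≢_; _≗_; refl; sym; trans; cong; cong₂; subst; subst₂; module ≡-Reasoning)
import Relation.Binary.Reasoning.StrictPartialOrder
open import Relation.Binary.Structures using (IsStrictTotalOrder)
open import Relation.Nullary using (¬_; yes; no)
open import Relation.Nullary.Decidable using (decidable-stable)

module ℕΣ = Algebra.Properties.Monoid.Sum ℕₚ.+-0-monoid

2∣⇒parity≡0ℙ : ∀ {k} → 2 ∣ k → parity k ≡ 0ℙ
2∣⇒parity≡0ℙ (divides q refl) = trans (*-homo-* q 2) (*-zeroʳ (parity q))

parity≡0ℙ⇒2∣ : ∀ k → parity k ≡ 0ℙ → 2 ∣ k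
parity≡0ℙ⇒2∣ zero          _  = divides 0 refl
parity≡0ℙ⇒2∣ (suc zero)    ()
parity≡0ℙ⇒2∣ (suc (suc k)) eq = ∣m∣n⇒∣m+n ∣-refl (parity≡0ℙ⇒2∣ k eq)

parity-suc : ∀ k → parity (suc k) ≡ parity k ⁻¹
parity-suc = +-homo-+ 1

n<2^n : ∀ n → n ℕ.< 2 ^ n
n<2^n zero    = s≤s z≤n
n<2^n (suc n) = ℕₚ.+-mono-≤ (ℕₚ.m^n>0 2 n) (ℕₚ.≤-trans (n<2^n n) (ℕₚ.m≤m+n (2 ^ n) 0))

2^n+2n≤3*2^n : ∀ n → 2 ^ n ℕ.+ (n ℕ.+ n) ℕ.≤ 3 ℕ.* 2 ^ n
2^n+2n≤3*2^n n = ℕₚ.+-monoʳ-≤ (2 ^ n) (ℕₚ.+-mono-≤ n≤2^n (ℕₚ.≤-trans n≤2^n (ℕₚ.m≤m+n (2 ^ n) 0)))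
  where
  n≤2^n = ℕₚ.<⇒≤ (n<2^n n)

-- The Boolean cube

Cube : ℕ → Set
Cube n = Fin n → Bool

bit : Bool → ℕ
bit false = 0
bit true  = 1

⟦_⟧ : ∀ {n} → Cube n → Fin n → ℤ
⟦ x ⟧ j = + bit (x j)

weight : ∀ {n} → Cube n → ℕ
weight x = ℕΣ.sum (bit ∘ x)

Even Odd : ∀ {n} → Cube n → Set
Even x = parity (weight x) ≡ 0ℙ
Odd  x = parity (weight x) ≡ 1ℙ

Binary : ∀ {n} → (Fin n → ℤ) → Set
Binary z = ∀ j → z j ≡ + 0 ⊎ z j ≡ + 1

Even⊎Odd : ∀ {n} (x : Cube n) → Even x ⊎ Odd x
Even⊎Odd x with parity (weight x)
... | 0ℙ = inj₁ refl
... | 1ℙ = inj₂ refl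

weight-cong : ∀ {n} {x y : Cube n} → x ≗ y → weight x ≡ weight y
weight-cong x≗y = ℕΣ.sum-cong-≗ (cong bit ∘ x≗y)

sumℤ-cong : ∀ {n} {z z′ : Fin n → ℤ} → z ≗ z′ → sumℤ z ≡ sumℤ z′
sumℤ-cong {zero}  eq = refl
sumℤ-cong {suc n} eq = cong₂ ℤ._+_ (eq zero) (sumℤ-cong (eq ∘ suc))

sumℤ-⟦⟧ : ∀ {n} (x : Cube n) → sumℤ ⟦ x ⟧ ≡ + weight x
sumℤ-⟦⟧ {zero}  x = refl
sumℤ-⟦⟧ {suc n} x = cong (ℤ._+_ (+ bit (x zero))) (sumℤ-⟦⟧ (x ∘ suc))

EVEN⇔Even : ∀ {n} {z : Fin n → ℤ} (x : Cube n) → ⟦ x ⟧ ≗ z → EVEN n z ⇔ Even x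
EVEN⇔Even {n} {z} x x≗z = mk⇔
  (λ (_ , 2∣z) → 2∣⇒parity≡0ℙ (subst (λ s → 2 ∣ ∣ s ∣) sumℤ≡weight 2∣z))
  (λ even → binary , subst (λ s → 2 ∣ ∣ s ∣) (sym sumℤ≡weight) (parity≡0ℙ⇒2∣ (weight x) even))
  where
  sumℤ≡weight : sumℤ z ≡ + weight x
  sumℤ≡weight = trans (sumℤ-cong (sym ∘ x≗z)) (sumℤ-⟦⟧ x)
  binary : Binary z
  binary j with x j | x≗z j
  ... | false | eq = inj₁ (sym eq)
  ... | true  | eq = inj₂ (sym eq)

fromBinary : ∀ {n} {z : Fin n → ℤ} → Binary z → Cube n
fromBinary binary j with binary j
... | inj₁ _ = false
... | inj₂ _ = true

⟦fromBinary⟧ : ∀ {n} {z : Fin n → ℤ} (binary : Binary z) → ⟦ fromBinary binary ⟧ ≗ z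
⟦fromBinary⟧ binary j with binary j
... | inj₁ eq = sym eq
... | inj₂ eq = sym eq

parity-weight-flip : ∀ {n} (x : Cube n) p → parity (weight (updateAt x p not)) ≡ parity (weight x) ⁻¹
parity-weight-flip x zero with x zero
... | false = parity-suc (weight (x ∘ suc))
... | true  = sym (suc-homo-⁻¹ (weight (x ∘ suc)))
parity-weight-flip x (suc p) with x zero
... | false = parity-weight-flip (x ∘ suc) p
... | true  = begin
  parity (suc (weight (updateAt (x ∘ suc) p not)))  ≡⟨ parity-suc (weight (updateAt (x ∘ suc) p not)) ⟩
  parity (weight (updateAt (x ∘ suc) p not)) ⁻¹     ≡⟨ cong _⁻¹ (parity-weight-flip (x ∘ suc) p) ⟩
  parity (weight (x ∘ suc)) ⁻¹ ⁻¹                   ≡⟨ cong _⁻¹ (parity-suc (weight (x ∘ suc))) ⟨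
  parity (suc (weight (x ∘ suc))) ⁻¹                ∎
  where open ≡-Reasoning

Odd⇒Even-flip : ∀ {n} {x : Cube n} p → Odd x → Even (updateAt x p not)
Odd⇒Even-flip {x = x} p odd = trans (parity-weight-flip x p) (cong _⁻¹ odd)

≢-witness : ∀ {n} {x y : Cube n} → ¬ (x ≗ y) → ∃ λ p → x p ≢ y p
≢-witness {n} {x} {y} = ¬∀⟶∃¬ n (λ j → x j ≡ y j) (λ j → x j ≟ᵇ y j)

Odd-Even-differ : ∀ {n} (x y : Cube n) → Odd x → Even y → ∃ λ p → x p ≢ y p
Odd-Even-differ x y odd even = ≢-witness λ x≗y →
  0ℙ≢1ℙ (trans (sym even) (trans (cong parity (sym (weight-cong x≗y))) odd))
  where
  0ℙ≢1ℙ : 0ℙ ≢ 1ℙ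
  0ℙ≢1ℙ ()

enumerate : ∀ n → Fin (2 ^ n) → Cube n
enumerate n k = Inverse.to 2↔Bool ∘ finToFun k

index : ∀ {n} → Cube n → Fin (2 ^ n)
index x = funToFin (Inverse.from 2↔Bool ∘ x)

enumerate-index : ∀ {n} (x : Cube n) → enumerate n (index x) ≗ x
enumerate-index x j = trans (cong (Inverse.to 2↔Bool) (finToFun-funToFin (Inverse.from 2↔Bool ∘ x) j))
                            (Inverse.strictlyInverseˡ 2↔Bool (x j))

funToFin-cong : ∀ {m n} {f g : Fin m → Fin n} → f ≗ g → funToFin f ≡ funToFin g
funToFin-cong {zero}  eq = refl
funToFin-cong {suc m} eq = cong₂ combine (eq zero) (funToFin-cong (eq ∘ suc))

enumerate-injective : ∀ n {k k′ : Fin (2 ^ n)} → enumerate n k ≗ enumerate n k′ → k ≡ k′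
enumerate-injective n {k} {k′} eq = begin
  k                                ≡⟨ funToFin-finToFin {n} {2} k ⟨
  funToFin (finToFun {2} {n} k)    ≡⟨ funToFin-cong finToFun-≗ ⟩
  funToFin (finToFun {2} {n} k′)   ≡⟨ funToFin-finToFin {n} {2} k′ ⟩
  k′                               ∎
  where
  open ≡-Reasoning
  open Inverse 2↔Bool using (from; strictlyInverseʳ)
  finToFun-≗ : finToFun {2} {n} k ≗ finToFun k′
  finToFun-≗ j = begin
    finToFun k j               ≡⟨ strictlyInverseʳ _ ⟨
    from (enumerate n k j)     ≡⟨ cong from (eq j) ⟩
    from (enumerate n k′ j)    ≡⟨ strictlyInverseʳ _ ⟩
    finToFun k′ j              ∎

oddVertex : ∀ n → Fin (2 ^ n) → Cube (suc n)
oddVertex n k = oddBit (parity (weight (enumerate n k))) ∷ enumerate n k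
  where
  oddBit : Parity → Bool
  oddBit 0ℙ = true
  oddBit 1ℙ = false

Odd-oddVertex : ∀ n k → Odd (oddVertex n k)
Odd-oddVertex n k with parity (weight (enumerate n k)) in eq
... | 0ℙ = trans (parity-suc (weight (enumerate n k))) (cong _⁻¹ eq)
... | 1ℙ = eq

oddVertex-distinct : ∀ n {k k′} → k ≢ k′ → ∃ λ p → oddVertex n k p ≢ oddVertex n k′ p
oddVertex-distinct n k≢k′ with ≢-witness (k≢k′ ∘ enumerate-injective n)
... | p , differ = suc p , differ

module _ (F : RealField) where
  open RealField F renaming (+-mono-< to +-monoˡ-<)
  open IsCommutativeRing isCommutativeRing
    using (+-comm; +-identityˡ; +-identityʳ; -‿inverseˡ; -‿inverseʳ;
           *-identityˡ; distribˡ; zeroˡ; zeroʳ)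
  open IsStrictTotalOrder isStrictTotalOrder using (compare) renaming (trans to <-trans; irrefl to <-irrefl)

  commutativeRing : CommutativeRing 0ℓ 0ℓ
  commutativeRing = record { isCommutativeRing = isCommutativeRing }

  strictTotalOrder : StrictTotalOrder 0ℓ 0ℓ 0ℓ
  strictTotalOrder = record { isStrictTotalOrder = isStrictTotalOrder }

  open Algebra.Properties.Ring (CommutativeRing.ring commutativeRing)
    using (-1*x≈-x; -0#≈0#; -‿involutive; //-rightDividesˡ; //-rightDividesʳ)
  open Algebra.Properties.CommutativeSemigroup (CommutativeRing.*-commutativeSemigroup commutativeRing)
    using (x∙yz≈y∙xz)
  open Algebra.Properties.Semiring.Sum (CommutativeRing.semiring commutativeRing)
    using (sum; sum-cong-≗; ∑-distrib-+; ∑-comm; *-distribˡ-sum; *-distribʳ-sum; sum-remove; sum-replicate-zero)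
  open import Relation.Binary.Properties.StrictTotalOrder strictTotalOrder using (_≤?_)
  module ≤-Reasoning = Relation.Binary.Reasoning.StrictPartialOrder
    (StrictTotalOrder.strictPartialOrder strictTotalOrder)

  -- Ordered fields

  ≤⇒≯ : ∀ {x y} → x ≤ y → ¬ (y < x)
  ≤⇒≯ (inj₁ x<y)  y<x = <-irrefl refl (<-trans x<y y<x)
  ≤⇒≯ (inj₂ refl) x<x = <-irrefl refl x<x

  ≰⇒> : ∀ {x y} → ¬ (x ≤ y) → y < x
  ≰⇒> {x} {y} x≰y with compare x y
  ... | tri< x<y _ _ = ⊥-elim (x≰y (inj₁ x<y))
  ... | tri≈ _ x≡y _ = ⊥-elim (x≰y (inj₂ x≡y))
  ... | tri> _ _ y<x = y<x

  +-monoʳ-< : ∀ {x y} z → x < y → z + x < z + y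
  +-monoʳ-< {x} {y} z x<y = subst₂ _<_ (+-comm x z) (+-comm y z) (+-monoˡ-< z x<y)

  +-monoˡ-≤ : ∀ {x y} z → x ≤ y → x + z ≤ y + z
  +-monoˡ-≤ z (inj₁ x<y)  = inj₁ (+-monoˡ-< z x<y)
  +-monoˡ-≤ z (inj₂ refl) = inj₂ refl

  +-monoʳ-≤ : ∀ {x y} z → x ≤ y → z + x ≤ z + y
  +-monoʳ-≤ z (inj₁ x<y)  = inj₁ (+-monoʳ-< z x<y)
  +-monoʳ-≤ z (inj₂ refl) = inj₂ refl

  +-mono-≤ : ∀ {x y u v} → x ≤ y → u ≤ v → x + u ≤ y + v
  +-mono-≤ {x} {y} {u} {v} x≤y u≤v = begin
    x + u ≤⟨ +-monoˡ-≤ u x≤y ⟩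
    y + u ≤⟨ +-monoʳ-≤ y u≤v ⟩
    y + v ∎
    where open ≤-Reasoning

  +-mono-< : ∀ {x y u v} → x < y → u < v → x + u < y + v
  +-mono-< {x} {y} {u} {v} x<y u<v = begin-strict
    x + u <⟨ +-monoˡ-< u x<y ⟩
    y + u <⟨ +-monoʳ-< y u<v ⟩
    y + v ∎
    where open ≤-Reasoning

  x<x+d : ∀ x {d} → 0# < d → x < x + d
  x<x+d x 0<d = subst (_< x + _) (+-identityʳ x) (+-monoʳ-< x 0<d)

  0<1 : 0# < 1#
  0<1 with compare 0# 1#
  ... | tri< 0<1 _ _ = 0<1
  ... | tri≈ _ 0≡1 _ = ⊥-elim (0≢1 0≡1)
  ... | tri> _ _ 1<0 = ⊥-elim (≤⇒≯ (inj₁ 1<0) (subst (0# <_) -1*-1≡1 (*-pos 0<-1 0<-1)))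
    where
    0<-1 : 0# < - 1#
    0<-1 = subst₂ _<_ (-‿inverseʳ 1#) (+-identityˡ (- 1#)) (+-monoˡ-< (- 1#) 1<0)
    -1*-1≡1 : - 1# * - 1# ≡ 1#
    -1*-1≡1 = trans (-1*x≈-x (- 1#)) (-‿involutive 1#)

  0<1+ιℕ : ∀ k → 0# < 1# + ιℕ F k
  0<1+ιℕ zero    = subst (0# <_) (sym (+-identityʳ 1#)) 0<1
  0<1+ιℕ (suc k) = <-trans (0<1+ιℕ zero) (+-monoʳ-< 1# (0<1+ιℕ k))

  *-monoˡ-≤-nonNeg : ∀ {w x y} → 0# ≤ w → x ≤ y → w * x ≤ w * y
  *-monoˡ-≤-nonNeg {w} {x} {y} (inj₂ refl) _ = inj₂ (trans (zeroˡ x) (sym (zeroˡ y)))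
  *-monoˡ-≤-nonNeg _ (inj₂ refl) = inj₂ refl
  *-monoˡ-≤-nonNeg {w} {x} {y} (inj₁ 0<w) (inj₁ x<y) = inj₁ (begin-strict
    w * x                   <⟨ x<x+d (w * x) (*-pos 0<w 0<y-x) ⟩
    w * x + w * (y + - x)   ≡⟨ distribˡ w x (y + - x) ⟨
    w * (x + (y + - x))     ≡⟨ cong (w *_) (trans (+-comm x (y + - x)) (//-rightDividesˡ x y)) ⟩
    w * y                   ∎)
    where
    open ≤-Reasoning
    0<y-x : 0# < y + - x
    0<y-x = subst (_< y + - x) (-‿inverseʳ x) (+-monoˡ-< (- x) x<y)

  sum-mono-≤ : ∀ {k} {f g : Fin k → Carrier} → (∀ i → f i ≤ g i) → sum f ≤ sum g
  sum-mono-≤ {zero}  f≤g = inj₂ refl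
  sum-mono-≤ {suc k} f≤g = +-mono-≤ (f≤g zero) (sum-mono-≤ (f≤g ∘ suc))

  sum-nonNeg : ∀ {k} {f : Fin k → Carrier} → (∀ i → 0# ≤ f i) → 0# ≤ sum f
  sum-nonNeg {k} {f} f≥0 = subst (_≤ sum f) (sum-replicate-zero k) (sum-mono-≤ f≥0)

  -- Linear inequalities and convex hulls

  Σ≡sum : ∀ {k} (f : Fin k → Carrier) → Σ[ F ] f ≡ sum f
  Σ≡sum {zero}  f = refl
  Σ≡sum {suc k} f = cong (_+_ (f zero)) (Σ≡sum (f ∘ suc))

  infix 8 _·_
  _·_ : ∀ {n} → Point F n → Point F n → Carrier
  a · x = sum λ j → a j * x j

  ·-congʳ : ∀ {n} {a x y : Point F n} → x ≗ y → a · x ≡ a · y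
  ·-congʳ {a = a} x≗y = sum-cong-≗ λ j → cong (a j *_) (x≗y j)

  ·-distrib-+ : ∀ {n} (a x y : Point F n) → a · (λ j → x j + y j) ≡ a · x + a · y
  ·-distrib-+ a x y = trans (sum-cong-≗ λ j → distribˡ (a j) (x j) (y j))
                            (∑-distrib-+ (λ j → a j * x j) (λ j → a j * y j))

  ·-combination : ∀ {n k} (a : Point F n) (w : Fin k → Carrier) (q : Fin k → Point F n) →
                  a · (λ j → sum λ i → w i * q i j) ≡ sum λ i → w i * (a · q i)
  ·-combination a w q = begin
    (sum λ j → a j * sum λ i → w i * q i j)    ≡⟨ sum-cong-≗ (λ j → *-distribˡ-sum (a j) λ i → w i * q i j) ⟩
    (sum λ j → sum λ i → a j * (w i * q i j))  ≡⟨ ∑-comm (λ i j → a j * (w i * q i j)) ⟨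
    (sum λ i → sum λ j → a j * (w i * q i j))  ≡⟨ sum-cong-≗ (λ i → sum-cong-≗ λ j → x∙yz≈y∙xz (a j) (w i) (q i j)) ⟩
    (sum λ i → sum λ j → w i * (a j * q i j))  ≡⟨ sum-cong-≗ (λ i → *-distribˡ-sum (w i) λ j → a j * q i j) ⟨
    (sum λ i → w i * (a · q i))                ∎
    where
    open ≡-Reasoning


  ∈P⇔ : ∀ {n m} (S : System F n m) {x : Point F n} →
        _∈P_ F x S ⇔ (∀ i → System.A S i · x ≤ System.b S i)
  ∈P⇔ S {x} = mk⇔ (λ x∈S i → subst (_≤ b i) (Σ≡sum λ j → A i j * x j) (x∈S i))
                  (λ rows i → subst (_≤ b i) (sym (Σ≡sum λ j → A i j * x j)) (rows i))
    where open System S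

  violated-row : ∀ {n m} (S : System F n m) {x : Point F n} → ¬ (_∈P_ F x S) →
                 ∃ λ i → System.b S i < System.A S i · x
  violated-row {m = m} S {x} x∉S with ¬∀⟶∃¬ m _ (λ i → A i · x ≤? b i) (x∉S ∘ Equivalence.from (∈P⇔ S))
    where open System S
  ... | i , row≰ = i , ≰⇒> row≰

  infixr 6 _∧_
  _∧_ : ∀ {n m₁ m₂} → System F n m₁ → System F n m₂ → System F n (m₁ ℕ.+ m₂)
  _∧_ {m₁ = m₁} S T = record
    { A = λ i → [ System.A S , System.A T ]′ (splitAt m₁ i)
    ; b = λ i → [ System.b S , System.b T ]′ (splitAt m₁ i)
    }

  ∈P-∧ : ∀ {n m₁ m₂} (S : System F n m₁) (T : System F n m₂) {x : Point F n} →
         _∈P_ F x (S ∧ T) ⇔ (_∈P_ F x S × _∈P_ F x T)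
  ∈P-∧ {m₁ = m₁} {m₂} S T {x} = mk⇔
    (λ x∈S∧T → (λ i → subst Row (splitAt-↑ˡ m₁ i m₂) (x∈S∧T (i ↑ˡ m₂)))
              , (λ i → subst Row (splitAt-↑ʳ m₁ m₂ i) (x∈S∧T (m₁ ↑ʳ i))))
    (λ (x∈S , x∈T) i → [_,_] {C = Row} x∈S x∈T (splitAt m₁ i))
    where
    Row : Fin m₁ ⊎ Fin m₂ → Set
    Row r = Σ[ F ] (λ j → [ System.A S , System.A T ]′ r j * x j) ≤ [ System.b S , System.b T ]′ r

  Valid : ∀ {n} → ((Fin n → ℤ) → Set) → Point F n → Carrier → Set
  Valid X a β = ∀ z → X z → a · embed F z ≤ β

  conv-valid : ∀ {n} {X : (Fin n → ℤ) → Set} {a β} → Valid X a β → ∀ {x} → _∈conv_ F x X → a · x ≤ β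
  conv-valid {a = a} {β} valid {x} (k , p , w , p∈X , w≥0 , ∑w≡1 , x≡∑wp) = begin
    a · x                                    ≡⟨ ·-congʳ (λ j → trans (sym (x≡∑wp j)) (Σ≡sum λ i → w i * ι F (p i j))) ⟩
    a · (λ j → sum λ i → w i * ι F (p i j))  ≡⟨ ·-combination a w (embed F ∘ p) ⟩
    (sum λ i → w i * (a · embed F (p i)))    ≤⟨ sum-mono-≤ (λ i → *-monoˡ-≤-nonNeg (w≥0 i) (valid (p i) (p∈X i))) ⟩
    (sum λ i → w i * β)                      ≡⟨ *-distribʳ-sum β w ⟨
    sum w * β                                ≡⟨ cong (_* β) (trans (sym (Σ≡sum w)) ∑w≡1) ⟩
    1# * β                                   ≡⟨ *-identityˡ β ⟩
    β                                        ∎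
    where open ≤-Reasoning

  ∈conv-self : ∀ {n} {X : (Fin n → ℤ) → Set} {z} → X z → _∈conv_ F (embed F z) X
  ∈conv-self {z = z} z∈X = 1 , (λ _ → z) , (λ _ → 1#) , (λ _ → z∈X) , (λ _ → inj₁ 0<1) ,
    +-identityʳ 1# , λ j → trans (+-identityʳ (1# * ι F (z j))) (*-identityˡ (ι F (z j)))

  conv⊆ : ∀ {n m} {X : (Fin n → ℤ) → Set} (S : System F n m) →
          (∀ z → X z → _∈P_ F (embed F z) S) → ∀ {x} → _∈conv_ F x X → _∈P_ F x S
  conv⊆ S X⊆S x∈conv = Equivalence.from (∈P⇔ S)
    λ i → conv-valid (λ z z∈X → Equivalence.to (∈P⇔ S) (X⊆S z z∈X) i) x∈conv

  relaxation-row-valid : ∀ {n m X} (S : System F n m) → IsRelaxation F X S →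
                         ∀ i → Valid X (System.A S i) (System.b S i)
  relaxation-row-valid {X = X} S rel i z z∈X =
    Equivalence.to (∈P⇔ S) (proj₂ (rel z) (∈conv-self {X = X} z∈X)) i

  -- Facets of the parity polytope

  -- embed F ⟦ x ⟧ j reduces to χ (x j).
  χ : Bool → Carrier
  χ b = ιℕ F (bit b)

  χ-nonNeg : ∀ b → 0# ≤ χ b
  χ-nonNeg false = inj₂ refl
  χ-nonNeg true  = inj₁ (0<1+ιℕ 0)

  sign : Bool → Carrier
  sign false = - 1#
  sign true  = 1#

  sign*χ+χ-xor : ∀ a b → sign a * χ b + χ (a xor b) ≡ χ a
  sign*χ+χ-xor false false = trans (+-identityʳ (- 1# * 0#)) (zeroʳ (- 1#))
  sign*χ+χ-xor false true  = trans (cong (_+ χ true) (-1*x≈-x (χ true))) (-‿inverseˡ (χ true))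
  sign*χ+χ-xor true  false = trans (cong (_+ χ true) (zeroʳ 1#)) (+-identityˡ (χ true))
  sign*χ+χ-xor true  true  = trans (+-identityʳ (1# * χ true)) (*-identityˡ (χ true))

  ‖_‖ : ∀ {n} → Cube n → Carrier
  ‖ y ‖ = sum (χ ∘ y)

  hamming : ∀ {n} → Cube n → Cube n → Carrier
  hamming y x = sum λ j → χ (y j xor x j)

  hamming-self : ∀ {n} (y : Cube n) → hamming y y ≡ 0#
  hamming-self {n} y = trans (sum-cong-≗ λ j → cong χ (xor-same (y j))) (sum-replicate-zero n)

  1≤hamming : ∀ {n} (y x : Cube n) {p} → y p ≢ x p → 1# ≤ hamming y x
  1≤hamming {suc n} y x {p} y≢x = begin
    1#                                  ≡⟨ +-identityʳ 1# ⟨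
    1# + 0#                             ≤⟨ +-mono-≤ (inj₂ (sym (+-identityʳ 1#))) rest≥0 ⟩
    χ true + sum (removeAt (χ ∘ d) p)   ≡⟨ cong (λ b → χ b + sum (removeAt (χ ∘ d) p)) (≢⇒xor≡true (y p) (x p) y≢x) ⟨
    χ (d p) + sum (removeAt (χ ∘ d) p)  ≡⟨ sum-remove (χ ∘ d) ⟨
    hamming y x                         ∎
    where
    open ≤-Reasoning
    d : Cube (suc n)
    d j = y j xor x j
    rest≥0 : 0# ≤ sum (removeAt (χ ∘ d) p)
    rest≥0 = sum-nonNeg λ j → χ-nonNeg (d (punchIn p j))
    ≢⇒xor≡true : ∀ a b → a ≢ b → a xor b ≡ true
    ≢⇒xor≡true false false a≢b = ⊥-elim (a≢b refl)
    ≢⇒xor≡true false true  _   = refl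
    ≢⇒xor≡true true  false _   = refl
    ≢⇒xor≡true true  true  a≢b = ⊥-elim (a≢b refl)

  facet-identity : ∀ {n} (y x : Cube n) → (sign ∘ y) · embed F ⟦ x ⟧ + hamming y x ≡ ‖ y ‖
  facet-identity y x = trans (sym (∑-distrib-+ (λ j → sign (y j) * χ (x j)) (λ j → χ (y j xor x j))))
                             (sum-cong-≗ λ j → sign*χ+χ-xor (y j) (x j))

  lowerIfOdd : Parity → Carrier → Carrier
  lowerIfOdd 0ℙ w = w
  lowerIfOdd 1ℙ w = w + - 1#

  facetBound : ∀ {n} → Cube n → Carrier
  facetBound y = lowerIfOdd (parity (weight y)) ‖ y ‖

  facet-valid-on-cube : ∀ {n} (y x : Cube n) → Even x → (sign ∘ y) · embed F ⟦ x ⟧ ≤ facetBound y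
  facet-valid-on-cube y x even with parity (weight y) in parity-y
  ... | 0ℙ = begin
    φ                ≡⟨ +-identityʳ φ ⟨
    φ + 0#           ≤⟨ +-monoʳ-≤ φ (sum-nonNeg λ j → χ-nonNeg (y j xor x j)) ⟩
    φ + hamming y x  ≡⟨ facet-identity y x ⟩
    ‖ y ‖            ∎
    where
    open ≤-Reasoning
    φ = (sign ∘ y) · embed F ⟦ x ⟧
  ... | 1ℙ = begin
    φ                       ≡⟨ //-rightDividesʳ 1# φ ⟨
    φ + 1# + - 1#           ≤⟨ +-monoˡ-≤ (- 1#) (+-monoʳ-≤ φ (1≤hamming y x y≢x)) ⟩
    φ + hamming y x + - 1#  ≡⟨ cong (_+ - 1#) (facet-identity y x) ⟩
    ‖ y ‖ + - 1#            ∎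
    where
    open ≤-Reasoning
    φ = (sign ∘ y) · embed F ⟦ x ⟧
    y≢x = proj₂ (Odd-Even-differ y x parity-y even)

  facet-valid : ∀ {n} (y : Cube n) → Valid (EVEN n) (sign ∘ y) (facetBound y)
  facet-valid y z z∈EVEN = subst (_≤ facetBound y)
    (·-congʳ (cong (ι F) ∘ ⟦fromBinary⟧ binary))
    (facet-valid-on-cube y x (Equivalence.to (EVEN⇔Even x (⟦fromBinary⟧ binary)) z∈EVEN))
    where
    binary = proj₁ z∈EVEN
    x = fromBinary binary

  facet-separates : ∀ {n} (y : Cube n) → Odd y → facetBound y < (sign ∘ y) · embed F ⟦ y ⟧
  facet-separates y odd = begin-strict
    facetBound y       ≡⟨ cong (λ q → lowerIfOdd q ‖ y ‖) odd ⟩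
    ‖ y ‖ + - 1#       <⟨ x<x+d (‖ y ‖ + - 1#) 0<1 ⟩
    ‖ y ‖ + - 1# + 1#  ≡⟨ //-rightDividesˡ 1# ‖ y ‖ ⟩
    ‖ y ‖              ≡⟨ facet-identity y y ⟨
    φ + hamming y y    ≡⟨ cong (_+_ φ) (hamming-self y) ⟩
    φ + 0#             ≡⟨ +-identityʳ φ ⟩
    φ                  ∎
    where
    open ≤-Reasoning
    φ = (sign ∘ y) · embed F ⟦ y ⟧

  -- Lower bound

  flip-exchange : ∀ {n} {y y′ : Cube n} {p} → y p ≢ y′ p → ∀ j →
                  χ (y j) + χ (y′ j) ≡ χ (updateAt y p not j) + χ (updateAt y′ p not j)
  flip-exchange {y = y} {y′} {p} y≢y′ j with j ≟ᶠ p
  ... | yes refl = trans (+-comm (χ (y p)) (χ (y′ p))) (cong₂ (λ a b → χ a + χ b)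
        (trans (¬-not (y≢y′ ∘ sym)) (sym (updateAt-updates p y)))
        (trans (¬-not y≢y′) (sym (updateAt-updates p y′))))
  ... | no j≢p = sym (cong₂ (λ a b → χ a + χ b) (updateAt-minimal j p y j≢p) (updateAt-minimal j p y′ j≢p))

  no-common-violation : ∀ {n} {a : Point F n} {β} → Valid (EVEN n) a β →
                        ∀ (y y′ : Cube n) {p} → Odd y → Odd y′ → y p ≢ y′ p →
                        β < a · embed F ⟦ y ⟧ → β < a · embed F ⟦ y′ ⟧ → ⊥
  no-common-violation {a = a} {β} valid y y′ {p} odd odd′ y≢y′ β<ay β<ay′ = begin-contradiction
    a · embed F ⟦ y ⟧ + a · embed F ⟦ y′ ⟧  ≡⟨ ·-distrib-+ a _ _ ⟨
    a · (λ j → χ (y j) + χ (y′ j))          ≡⟨ ·-congʳ (flip-exchange {y = y} {y′} y≢y′) ⟩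
    a · (λ j → χ (z j) + χ (z′ j))          ≡⟨ ·-distrib-+ a _ _ ⟩
    a · embed F ⟦ z ⟧ + a · embed F ⟦ z′ ⟧  ≤⟨ +-mono-≤ (valid-on-even z (Odd⇒Even-flip p odd))
                                                         (valid-on-even z′ (Odd⇒Even-flip p odd′)) ⟩
    β + β                                   <⟨ +-mono-< β<ay β<ay′ ⟩
    a · embed F ⟦ y ⟧ + a · embed F ⟦ y′ ⟧  ∎
    where
    open ≤-Reasoning
    z  = updateAt y p not
    z′ = updateAt y′ p not
    valid-on-even : ∀ x → Even x → a · embed F ⟦ x ⟧ ≤ β
    valid-on-even x even = valid ⟦ x ⟧ (Equivalence.from (EVEN⇔Even x λ _ → refl) even)

  odd∉relaxation : ∀ {n m} (S : System F n m) → IsRelaxation F (EVEN n) S →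
                   ∀ y → Odd y → ¬ (_∈P_ F (embed F ⟦ y ⟧) S)
  odd∉relaxation S rel y odd y∈S =
    ≤⇒≯ (conv-valid (facet-valid y) (proj₁ (rel ⟦ y ⟧) y∈S)) (facet-separates y odd)

  relaxation-size : ∀ {n m} (S : System F (suc n) m) → IsRelaxation F (EVEN (suc n)) S → 2 ^ n ℕ.≤ m
  -- f is given explicitly: inferring it from the type of violated-injective would normalise violation.
  relaxation-size {n} {m} S rel = injective⇒≤ {f = violated} violated-injective
    where
    open System S
    violation : ∀ k → ∃ λ i → b i < A i · embed F ⟦ oddVertex n k ⟧
    violation k = violated-row S {embed F ⟦ oddVertex n k ⟧}
                    (odd∉relaxation S rel (oddVertex n k) (Odd-oddVertex n k))
    violated : Fin (2 ^ n) → Fin m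
    violated = proj₁ ∘ violation
    violated-injective : Injective _≡_ _≡_ violated
    violated-injective {k} {k′} same = decidable-stable (k ≟ᶠ k′) λ k≢k′ →
      no-common-violation {a = A i} (relaxation-row-valid S rel i)
        (oddVertex n k) (oddVertex n k′) (Odd-oddVertex n k) (Odd-oddVertex n k′)
        (proj₂ (oddVertex-distinct n k≢k′))
        (proj₂ (violation k))
        (subst (λ i → b i < A i · embed F ⟦ oddVertex n k′ ⟧) (sym same) (proj₂ (violation k′)))
      where i = violated k

  -- Upper bound

  axis : ∀ {n} → Fin n → Carrier → Point F n
  axis zero    c zero    = c
  axis zero    c (suc _) = 0#
  axis (suc j) c zero    = 0#
  axis (suc j) c (suc l) = axis j c l

  ·-axis : ∀ {n} (j : Fin n) c (x : Point F n) → axis j c · x ≡ c * x j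
  ·-axis {suc n} zero c x = begin
    c * x zero + (sum λ l → 0# * x (suc l))  ≡⟨ cong (_+_ (c * x zero)) (sum-cong-≗ λ l → zeroˡ (x (suc l))) ⟩
    c * x zero + sum {n} (λ _ → 0#)          ≡⟨ cong (_+_ (c * x zero)) (sum-replicate-zero n) ⟩
    c * x zero + 0#                          ≡⟨ +-identityʳ (c * x zero) ⟩
    c * x zero                               ∎
    where open ≡-Reasoning
  ·-axis {suc n} (suc j) c x = trans (cong (_+ axis j c · (x ∘ suc)) (zeroˡ (x zero)))
                                     (trans (+-identityˡ (axis j c · (x ∘ suc))) (·-axis j c (x ∘ suc)))

  ι∈[0,1]⇒binary : ∀ a → ι F a ≤ 1# → - ι F a ≤ 0# → a ≡ + 0 ⊎ a ≡ + 1
  ι∈[0,1]⇒binary (+ 0)           _   _    = inj₁ refl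
  ι∈[0,1]⇒binary (+ 1)           _   _    = inj₂ refl
  ι∈[0,1]⇒binary (+ suc (suc k)) ι≤1 _    = ⊥-elim (≤⇒≯ ι≤1 (x<x+d 1# (0<1+ιℕ k)))
  ι∈[0,1]⇒binary -[1+ k ]        _   -ι≤0 = ⊥-elim (≤⇒≯ -ι≤0 (subst (0# <_) (sym (-‿involutive _)) (0<1+ιℕ k)))

  binary⇒ι∈[0,1] : ∀ {a} → a ≡ + 0 ⊎ a ≡ + 1 → ι F a ≤ 1# × - ι F a ≤ 0#
  binary⇒ι∈[0,1] (inj₁ refl) = inj₁ 0<1 , inj₂ -0#≈0#
  binary⇒ι∈[0,1] (inj₂ refl) = inj₂ (+-identityʳ 1#) ,
    inj₁ (subst₂ _<_ (+-identityˡ _) (-‿inverseʳ _) (+-monoˡ-< (- ι F (+ 1)) (0<1+ιℕ 0)))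

  upperBox lowerBox : ∀ n → System F n n
  upperBox n = record { A = λ j → axis j 1#     ; b = λ _ → 1# }
  lowerBox n = record { A = λ j → axis j (- 1#) ; b = λ _ → 0# }

  box : ∀ n → System F n (n ℕ.+ n)
  box n = upperBox n ∧ lowerBox n

  ∈box⇔Binary : ∀ {n} {z : Fin n → ℤ} → _∈P_ F (embed F z) (box n) ⇔ Binary z
  ∈box⇔Binary {n} {z} = mk⇔
    (λ z∈box j → let z∈upper , z∈lower = to (∈P-∧ (upperBox n) (lowerBox n)) z∈box in
      ι∈[0,1]⇒binary (z j) (subst (_≤ 1#) (upper-row j) (to (∈P⇔ (upperBox n)) z∈upper j))
                           (subst (_≤ 0#) (lower-row j) (to (∈P⇔ (lowerBox n)) z∈lower j)))
    (λ binary → from (∈P-∧ (upperBox n) (lowerBox n))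
      ( from (∈P⇔ (upperBox n)) (λ j → subst (_≤ 1#) (sym (upper-row j)) (proj₁ (binary⇒ι∈[0,1] (binary j))))
      , from (∈P⇔ (lowerBox n)) (λ j → subst (_≤ 0#) (sym (lower-row j)) (proj₂ (binary⇒ι∈[0,1] (binary j))))))
    where
    open Equivalence using (to; from)
    upper-row : ∀ j → axis j 1# · embed F z ≡ ι F (z j)
    upper-row j = trans (·-axis j 1# (embed F z)) (*-identityˡ (ι F (z j)))
    lower-row : ∀ j → axis j (- 1#) · embed F z ≡ - ι F (z j)
    lower-row j = trans (·-axis j (- 1#) (embed F z)) (-1*x≈-x (ι F (z j)))

  -- The rows for even vertices are redundant; they let the rows be indexed by all of Fin (2 ^ n).
  facets : ∀ n → System F n (2 ^ n)
  facets n = record { A = λ k → sign ∘ enumerate n k ; b = λ k → facetBound (enumerate n k) }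

  evenSystem : ∀ n → System F n (2 ^ n ℕ.+ (n ℕ.+ n))
  evenSystem n = facets n ∧ box n

  odd∉facets : ∀ {n} {z : Fin n → ℤ} (x : Cube n) → ⟦ x ⟧ ≗ z → Odd x → ¬ (_∈P_ F (embed F z) (facets n))
  odd∉facets {n} {z} x x≗z odd z∈facets = begin-contradiction
    facetBound y                <⟨ facet-separates y (trans (cong parity (weight-cong y≗x)) odd) ⟩
    (sign ∘ y) · embed F ⟦ y ⟧  ≡⟨ ·-congʳ (λ j → cong (ι F) (trans (cong (+_ ∘ bit) (y≗x j)) (x≗z j))) ⟩
    (sign ∘ y) · embed F z      ≤⟨ Equivalence.to (∈P⇔ (facets n)) z∈facets (index x) ⟩
    facetBound y                ∎
    where
    open ≤-Reasoning
    y = enumerate n (index x)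
    y≗x = enumerate-index x

  evenSystem-relaxation : ∀ n → IsRelaxation F (EVEN n) (evenSystem n)
  evenSystem-relaxation n z = integral , conv⊆ (evenSystem n) EVEN⊆evenSystem
    where
    EVEN⊆evenSystem : ∀ z → EVEN n z → _∈P_ F (embed F z) (evenSystem n)
    EVEN⊆evenSystem z z∈EVEN = Equivalence.from (∈P-∧ (facets n) (box n))
      ( Equivalence.from (∈P⇔ (facets n)) (λ k → facet-valid (enumerate n k) z z∈EVEN)
      , Equivalence.from ∈box⇔Binary (proj₁ z∈EVEN) )
    integral : _∈P_ F (embed F z) (evenSystem n) → _∈conv_ F (embed F z) (EVEN n)
    integral z∈S = [ (λ even → ∈conv-self {X = EVEN n} (Equivalence.from (EVEN⇔Even x x≗z) even))
                   , (λ odd → ⊥-elim (odd∉facets x x≗z odd z∈facets)) ]′ (Even⊎Odd x)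
      where
      z∈facets = proj₁ (Equivalence.to (∈P-∧ (facets n) (box n)) z∈S)
      binary : Binary z
      binary = Equivalence.to ∈box⇔Binary (proj₂ (Equivalence.to (∈P-∧ (facets n) (box n)) z∈S))
      x = fromBinary binary
      x≗z = ⟦fromBinary⟧ binary

open import Data.Nat.Base using (_≤_; _*_)

theorem7 : (F : RealField) →
    ∃ λ a → ∃ λ b → ∃ λ N → ∀ n → N ≤ n →
      (Σ ℕ λ m → Σ (System F n m) λ S →
          IsRelaxation F (EVEN n) S × m ≤ b * 2 ^ n) ×
      (∀ m (S : System F n m) → IsRelaxation F (EVEN n) S → 2 ^ n ≤ a * m)
theorem7 F = 2 , 3 , 1 , λ where
  (suc n) _ → (_ , evenSystem F (suc n) , evenSystem-relaxation F (suc n) , 2^n+2n≤3*2^n (suc n))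
            , λ m S rel → ℕₚ.*-monoʳ-≤ 2 (relaxation-size F S rel)
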